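{- Let $r,s\ge1$, $\mathbb{F}$ a field, and let $N$ be a positive integer with $r\le N\le rs$. Let $0\le i_1<\dots<i_r\le r+s-1$ and $0\le j_1<\dots<j_r\le r+s-1$ be integers with $i_1+\dots+i_r=N=j_1+\dots+j_r$ and $(i_1,\dots,i_r)\ne(j_1,\dots,j_r)$. Then there is a Plücker relation (for Plücker coordinates of rank-$r$ subspaces of $\mathbb{F}^{r+s}$) which, after writing every coordinate with increasingly ordered indices using the alternating property, has the form $$H_{i_1\dots i_r}H_{j_1\dots j_r}+\Sigma=0,$$ where $\Sigma$ is a sum of terms $\pm H_{k_1\dots k_r}H_{n_1\dots n_r}$ each satisfying $k_1+\dots+k_r<N<n_1+\dots+n_r$.
   Context: For a linear subspace $H\le\mathbb{F}^{r+s}$ of rank $r$ with basis $a(1),\dots,a(r)$ (coordinates indexed $0,\dots,r+s-1$), its Plücker coordinates are $H_{i_1\dots i_r}=\det\big(a(p)_{i_q}\big)_{p,q=1}^{r}$ for $i_1,\dots,i_r\in\{0,\dots,r+s-1\}$; they are alternating in the indices (zero if two indices coincide) and determined up to a common nonzero scalar. The Plücker relations are, for every $2r$-tuple $(i_1,\dots,i_{r-1},j_0,j_1,\dots,j_r)$ of indices, $\sum_{n=0}^{r}(-1)^nH_{i_1\dots i_{r-1}j_n}H_{j_0\dots\widehat{j_n}\dots j_r}=0$, where $\widehat{j_n}$ means $j_n$ is omitted. -}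

module Defs where

open import Data.Bool using (Bool; true; false; if_then_else_; _∨_)
open import Data.Nat using (ℕ; zero; suc; _+_; _<_; _<ᵇ_; _≡ᵇ_; _%_)
open import Data.Nat.Properties using (≤-decTotalOrder)
open import Data.Fin using (Fin; toℕ)
open import Data.List using (List; []; _∷_; _++_; [_]; length; filter; lookup; removeAt; allFin; map; mapMaybe)
open import Data.Bool.ListAction using (any)
open import Data.Maybe using (Maybe; just; nothing)
open import Data.Product using (_×_; _,_)
open import Data.Sign using (Sign) renaming (_*_ to _*ₛ_)
open import Relation.Nullary.Decidable using (does)
open import Data.Nat using (_<?_)
open import Relation.Binary.PropositionalEquality using (_≡_)
open import Data.List.Relation.Unary.All using (All)
open import Data.List.Sort.MergeSort ≤-decTotalOrder using (sort)

inversions : List ℕ → ℕ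
inversions []       = 0
inversions (x ∷ xs) = length (filter (λ y → y <? x) xs) + inversions xs

-- sign of the permutation sorting a (duplicate-free) list
parity : ℕ → Sign
parity n = if n % 2 ≡ᵇ 0 then Sign.+ else Sign.-

sortSign : List ℕ → Sign
sortSign xs = parity (inversions xs)

hasDup : List ℕ → Bool
hasDup []       = false
hasDup (x ∷ xs) = any (λ y → x ≡ᵇ y) xs ∨ hasDup xs

-- Alternating property: H_{xs} = 0 if an index repeats, otherwise
-- H_{xs} = sortSign xs · H_{sort xs}.  A normalised coordinate.
normCoord : List ℕ → Maybe (Sign × List ℕ)
normCoord xs = if hasDup xs then nothing else just (sortSign xs , sort xs)

-- A normalised quadratic term  ε · H_K · H_L  is  (ε , K , L).
Term : Set
Term = Sign × List ℕ × List ℕ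

normTerm : Sign → List ℕ → List ℕ → Maybe Term
normTerm σ xs ys with normCoord xs | normCoord ys
... | just (ε₁ , K) | just (ε₂ , L) = just (σ *ₛ ε₁ *ₛ ε₂ , K , L)
... | _             | _             = nothing

-- The Plücker relation for the tuple (i_1..i_{r-1}, j_0..j_r):
--   Σ_n (-1)^n H_{i_1..i_{r-1} j_n} H_{j_0..ĵ_n..j_r} = 0,
-- written with increasingly ordered indices, vanishing terms dropped.
pluckerTerms : (is js : List ℕ) → List Term
pluckerTerms is js =
  mapMaybe (λ n → normTerm (parity (toℕ n)) (is ++ [ lookup js n ]) (removeAt js n))
           (allFin (length js))

-- the data (i_1..i_{r-1}, j_0..j_r) of a Plücker relation for rank r
-- subspaces of F^{r+s}
record PluckerTuple (r s : ℕ) : Set where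
  field
    is     : List ℕ
    js     : List ℕ
    is-len : length is + 1 ≡ r
    js-len : length js ≡ suc r
    is-bnd : All (λ x → x < r + s) is
    js-bnd : All (λ x → x < r + s) js

module Submission where

-- Since I ≠ J are strictly increasing, one of them contains an
-- index x missing from the other; say x ∈ I, x ∉ J.  Write I as a permutation
-- of  is ++ [x]  (so |is| = r-1) and take the Plücker relation for the tuple
-- (is ; js), where js is J with x inserted at position 0 or 1, the position
-- being chosen so that its sign (-1)^pos cancels the sign of sorting is ++ [x].
-- The term exchanging x is then exactly  + H_I H_J.  Every other term
-- exchanges some j ∈ J, j ≠ x, and equals ± H_{is,j} H_{js∖j}; its index sums
-- are N - x + j and N + x - j, so one lies strictly below N and the other
-- strictly above.

open import Defs
open import Data.Nat using (ℕ; _≤_; _<_; _+_; _*_)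
open import Data.List using (List; _∷_; length)
open import Data.Nat.ListAction using (sum)
open import Data.List.Relation.Unary.All using (All)
open import Data.List.Relation.Unary.Linked using (Linked; [-]; _∷_)
open import Data.List.Relation.Binary.Permutation.Propositional using (_↭_)
open import Data.Product using (Σ; ∃; _×_; _,_)
open import Data.Sum using (_⊎_)
open import Data.Sign using (Sign)
open import Relation.Binary.PropositionalEquality using (_≡_; _≢_)

open import Function using (_∘_)
open import Data.Nat using (zero; suc; _≡ᵇ_; _<?_)
open import Data.Nat.Properties using
  (≤-decTotalOrder; ≤-totalOrder; ≤-trans; <-cmp; <-trans; <-irrefl; <⇒≤; <⇒≱; ≡ᵇ⇒≡;
   +-assoc; +-comm; +-identityʳ; +-monoʳ-<; +-cancelʳ-<)
open import Data.Nat.ListAction.Properties using (sum-↭; sum-++)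
open import Data.Bool using (true; false; T)
open import Data.Bool.ListAction using (any)
open import Data.Maybe using (Maybe; just; nothing)
open import Data.Fin using (Fin; toℕ) renaming (zero to fz; suc to fs)
open import Data.List using ([]; _++_; [_]; lookup; removeAt; tabulate; catMaybes)
open import Data.List.Properties using (map-tabulate; filter-none; length-++; ++-assoc)
open import Data.List.Relation.Unary.All using ([]; _∷_)
import Data.List.Relation.Unary.All as All
open import Data.List.Relation.Unary.All.Properties using (++⁻ˡ)
open import Data.List.Relation.Unary.AllPairs using ([]; _∷_)
import Data.List.Relation.Unary.AllPairs as AllPairs
open import Data.List.Relation.Unary.Unique.Propositional using (Unique)
import Data.List.Relation.Unary.Linked as Linked
open import Data.List.Relation.Unary.Linked.Properties using (Linked⇒All; Linked⇒AllPairs)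
open import Data.List.Relation.Unary.Any using (here; there)
open import Data.List.Membership.Propositional using (_∈_; _∉_)
open import Data.List.Membership.Propositional.Properties using (∈-∃++; ∈-lookup)
open import Data.List.Relation.Binary.Permutation.Propositional using
  (↭-sym; ↭-trans; ↭-refl; ↭-reflexive; ↭⇒↭ₛ; prep; swap)
open import Data.List.Relation.Binary.Permutation.Propositional.Properties using
  (↭-length; All-resp-↭; ++⁺ˡ; ∷↭∷ʳ)
open import Data.List.Relation.Binary.Permutation.Setoid.Properties using (Unique-resp-↭)
open import Data.List.Relation.Unary.Sorted.TotalOrder.Properties using (↗↭↗⇒≋)
open import Data.List.Relation.Binary.Pointwise using (Pointwise-≡⇒≡)
open import Data.List.Sort.MergeSort ≤-decTotalOrder using (sort; mergeSort)
open import Data.List.Sort.Base using (SortingAlgorithm)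
open import Data.Sign using () renaming (_*_ to _*ₛ_)
open import Data.Sign.Properties using (*-identityʳ)
open import Data.Empty using (⊥-elim)
open import Data.Sum using (inj₁; inj₂)
open import Relation.Binary.Definitions using (tri<; tri≈; tri>)
open import Relation.Binary.PropositionalEquality using (refl; sym; trans; cong; subst; setoid; module ≡-Reasoning)

open SortingAlgorithm mergeSort using (sort-↭; sort-↗)

sort-of-perm : ∀ {xs ys} → xs ↭ ys → Linked _≤_ ys → sort xs ≡ ys
sort-of-perm {xs} p ys↗ = Pointwise-≡⇒≡
  (↗↭↗⇒≋ ≤-totalOrder (sort-↗ xs) ys↗ (↭⇒↭ₛ (↭-trans (sort-↭ xs) p)))

strict⇒Unique : ∀ {xs} → Linked _<_ xs → Unique xs
strict⇒Unique l = AllPairs.map (λ { x<y refl → <-irrefl refl x<y }) (Linked⇒AllPairs <-trans l)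

any-≢ : ∀ x ys → All (x ≢_) ys → any (x ≡ᵇ_) ys ≡ false
any-≢ x []       []          = refl
any-≢ x (y ∷ ys) (x≢y ∷ x≢ys) with x ≡ᵇ y in eq
... | true  = ⊥-elim (x≢y (≡ᵇ⇒≡ x y (subst T (sym eq) _)))
... | false = any-≢ x ys x≢ys

hasDup-Unique : ∀ {xs} → Unique xs → hasDup xs ≡ false
hasDup-Unique {[]}     []           = refl
hasDup-Unique {x ∷ xs} (x∉xs ∷ uxs) rewrite any-≢ x xs x∉xs = hasDup-Unique uxs

head-bounds : ∀ {R : ℕ → ℕ → Set} → (∀ {a b c} → R a b → R b c → R a c) →
  ∀ {x xs} → Linked R (x ∷ xs) → All (R x) xs
head-bounds trans-R [-]        = []
head-bounds trans-R (Rxy ∷ l) = Linked⇒All trans-R Rxy l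

inversions-sorted : ∀ {xs} → Linked _≤_ xs → inversions xs ≡ 0
inversions-sorted {[]}     _ = refl
inversions-sorted {x ∷ xs} l
  rewrite filter-none (_<? x) (All.map (λ x≤y y<x → <⇒≱ y<x x≤y) (head-bounds ≤-trans l))
  = inversions-sorted (Linked.tail l)

normCoord-perm : ∀ {xs X} → xs ↭ X → Linked _<_ X → normCoord xs ≡ just (sortSign xs , X)
normCoord-perm {xs} p X↗
  rewrite hasDup-Unique (Unique-resp-↭ (setoid ℕ) (↭⇒↭ₛ (↭-sym p)) (strict⇒Unique X↗))
        | sort-of-perm p (Linked.map <⇒≤ X↗)
  = refl

normCoord-sorted : ∀ {X} → Linked _<_ X → normCoord X ≡ just (Sign.+ , X)
normCoord-sorted {X} X↗ rewrite normCoord-perm ↭-refl X↗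
                             | inversions-sorted (Linked.map <⇒≤ X↗) = refl

normCoord-sum : ∀ xs {ε K} → normCoord xs ≡ just (ε , K) → sum K ≡ sum xs
normCoord-sum xs eq with hasDup xs
normCoord-sum xs refl | false = sum-↭ (sort-↭ xs)

normTerm-sums : ∀ σ xs ys {ε K L} → normTerm σ xs ys ≡ just (ε , K , L) →
  sum K ≡ sum xs × sum L ≡ sum ys
normTerm-sums σ xs ys eq with normCoord xs in e₁ | normCoord ys in e₂
normTerm-sums σ xs ys refl | just _ | just _ = normCoord-sum xs e₁ , normCoord-sum ys e₂

catMaybes-tabulate-All : ∀ {A : Set} {P : A → Set} {m} (g : Fin m → Maybe A) →
  (∀ i {u} → g i ≡ just u → P u) → All P (catMaybes (tabulate g))
catMaybes-tabulate-All {m = zero}  g all = []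
catMaybes-tabulate-All {m = suc m} g all with g fz in eq
... | just u  = all fz eq ∷ catMaybes-tabulate-All (g ∘ fs) (all ∘ fs)
... | nothing = catMaybes-tabulate-All (g ∘ fs) (all ∘ fs)

catMaybes-tabulate-extract : ∀ {A : Set} {P : A → Set} {m} (g : Fin m → Maybe A) (k : Fin m) {t} →
  g k ≡ just t → (∀ i → i ≡ k ⊎ (∀ {u} → g i ≡ just u → P u)) →
  ∃ λ rest → catMaybes (tabulate g) ↭ t ∷ rest × All P rest
catMaybes-tabulate-extract g fz gk others with g fz
catMaybes-tabulate-extract {P = P} g fz refl others | just _ =
  _ , ↭-refl , catMaybes-tabulate-All (g ∘ fs) (λ i → off-k (others (fs i)))
  where
  off-k : ∀ {i} → fs i ≡ fz ⊎ (∀ {u} → g (fs i) ≡ just u → P u) → ∀ {u} → g (fs i) ≡ just u → P u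
  off-k (inj₂ P-gi) = P-gi
catMaybes-tabulate-extract {P = P} g (fs k) gk others
  with catMaybes-tabulate-extract (g ∘ fs) k gk (λ i → shift (others (fs i)))
  where
  shift : ∀ {i} → fs i ≡ fs k ⊎ (∀ {u} → g (fs i) ≡ just u → P u) → i ≡ k ⊎ (∀ {u} → g (fs i) ≡ just u → P u)
  shift (inj₁ refl) = inj₁ refl
  shift (inj₂ p)    = inj₂ p
... | rest , perm , all-rest with g fz | others fz
...   | nothing | _        = rest , perm , all-rest
...   | just u  | inj₂ P-u = u ∷ rest , ↭-trans (prep u perm) (swap u _ ↭-refl) , P-u refl ∷ all-rest

Strict : ℕ → Term → Set
Strict N (_ , K , L) = (sum K < N × N < sum L) ⊎ (sum L < N × N < sum K)

-- Exchanging x for j ≠ x moves the two index sums to opposite sides of N.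
exchange-sums : ∀ {a l x j N} → a + x ≡ N → l + j ≡ N + x → j ≢ x →
  (a + j < N × N < l) ⊎ (l < N × N < a + j)
exchange-sums {a} {l} {x} {j} {N} a+x≡N l+j≡N+x j≢x with <-cmp j x
... | tri< j<x _ _ = inj₁ (subst (a + j <_) a+x≡N (+-monoʳ-< a j<x) ,
                          +-cancelʳ-< j N l (subst (N + j <_) (sym l+j≡N+x) (+-monoʳ-< N j<x)))
... | tri≈ _ j≡x _ = ⊥-elim (j≢x j≡x)
... | tri> _ _ x<j = inj₂ (+-cancelʳ-< j l N (subst (_< N + j) (sym l+j≡N+x) (+-monoʳ-< N x<j)) ,
                          subst (_< a + j) a+x≡N (+-monoʳ-< a x<j))

sum-snoc : ∀ xs x → sum (xs ++ [ x ]) ≡ sum xs + x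
sum-snoc xs x = trans (sum-++ xs [ x ]) (cong (sum xs +_) (+-identityʳ x))

sum-removeAt : ∀ xs i → sum (removeAt xs i) + lookup xs i ≡ sum xs
sum-removeAt (x ∷ xs) fz     = +-comm (sum xs) x
sum-removeAt (x ∷ xs) (fs i) = trans (+-assoc x _ _) (cong (x +_) (sum-removeAt xs i))

exchange-strict : ∀ {N x j σ t} is ys → sum is + x ≡ N → sum ys + j ≡ N + x → j ≢ x →
  normTerm σ (is ++ [ j ]) ys ≡ just t → Strict N t
exchange-strict {j = j} {σ = σ} {t = _ , K , L} is ys is+x ys+j j≢x eq
  with normTerm-sums σ (is ++ [ j ]) ys eq
... | sK , sL rewrite sK | sL | sum-snoc is j = exchange-sums is+x ys+j j≢x

record Placement (ε : Sign) (x : ℕ) (Y : List ℕ) : Set where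
  field
    js      : List ℕ
    pos     : Fin (length js)
    perm    : js ↭ x ∷ Y
    at-pos  : lookup js pos ≡ x
    removed : removeAt js pos ≡ Y
    cancels : parity (toℕ pos) *ₛ ε ≡ Sign.+
    only-x  : ∀ i → i ≡ pos ⊎ lookup js i ≢ x

lookup-∉ : ∀ {x : ℕ} {Y : List ℕ} → x ∉ Y → ∀ i → lookup Y i ≢ x
lookup-∉ {Y = Y} x∉Y i eq = x∉Y (subst (_∈ Y) eq (∈-lookup i))

place : ∀ ε x y Y → x ∉ y ∷ Y → Placement ε x (y ∷ Y)
place Sign.+ x y Y x∉Y = record
  { js = x ∷ y ∷ Y ; pos = fz ; perm = ↭-refl ; at-pos = refl ; removed = refl ; cancels = refl
  ; only-x = λ { fz → inj₁ refl ; (fs i) → inj₂ (lookup-∉ {Y = y ∷ Y} x∉Y i) } }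
place Sign.- x y Y x∉Y = record
  { js = y ∷ x ∷ Y ; pos = fs fz ; perm = swap y x ↭-refl ; at-pos = refl ; removed = refl ; cancels = refl
  ; only-x = λ { fz → inj₂ (lookup-∉ {Y = y ∷ Y} x∉Y fz)
               ; (fs fz) → inj₁ refl
               ; (fs (fs i)) → inj₂ (lookup-∉ {Y = Y} (x∉Y ∘ there) i) } }

pluckerTerm : (is js : List ℕ) → Fin (length js) → Maybe Term
pluckerTerm is js n = normTerm (parity (toℕ n)) (is ++ [ lookup js n ]) (removeAt js n)

pluckerTerms-tabulate : ∀ is js → pluckerTerms is js ≡ catMaybes (tabulate (pluckerTerm is js))
pluckerTerms-tabulate is js = cong catMaybes (map-tabulate (λ n → n) (pluckerTerm is js))

exchangeRelation : ∀ {N x} is {X Y} → is ++ [ x ] ↭ X → Linked _<_ X → Linked _<_ Y →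
  sum X ≡ N → sum Y ≡ N → (pl : Placement (sortSign (is ++ [ x ])) x Y) →
  ∃ λ rest → pluckerTerms is (Placement.js pl) ↭ (Sign.+ , X , Y) ∷ rest × All (Strict N) rest
exchangeRelation {N} {x} is {X} {Y} perm-X X↗ Y↗ sum-X sum-Y pl =
  subst (λ terms → ∃ λ rest → terms ↭ (Sign.+ , X , Y) ∷ rest × All (Strict N) rest)
        (sym (pluckerTerms-tabulate is js))
        (catMaybes-tabulate-extract (pluckerTerm is js) pos leading other)
  where
  open Placement pl
  leading : pluckerTerm is js pos ≡ just (Sign.+ , X , Y)
  leading rewrite at-pos | removed | normCoord-perm perm-X X↗ | normCoord-sorted Y↗
                | *-identityʳ (parity (toℕ pos) *ₛ sortSign (is ++ [ x ])) | cancels = refl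
  is+x : sum is + x ≡ N
  is+x = trans (sym (sum-snoc is x)) (trans (sum-↭ perm-X) sum-X)
  js-sum : ∀ i → sum (removeAt js i) + lookup js i ≡ N + x
  js-sum i = begin
    sum (removeAt js i) + lookup js i ≡⟨ sum-removeAt js i ⟩
    sum js                            ≡⟨ sum-↭ perm ⟩
    x + sum Y                         ≡⟨ cong (x +_) sum-Y ⟩
    x + N                             ≡⟨ +-comm x N ⟩
    N + x                             ∎
    where open ≡-Reasoning
  other : ∀ i → i ≡ pos ⊎ (∀ {u} → pluckerTerm is js i ≡ just u → Strict N u)
  other i with only-x i
  ... | inj₁ i≡pos = inj₁ i≡pos
  ... | inj₂ j≢x   = inj₂ (exchange-strict is (removeAt js i) is+x (js-sum i) j≢x)

Diff : List ℕ → List ℕ → Set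
Diff I J = ∃ λ x → x ∈ I × x ∉ J

∉-below-head : ∀ {a b J} → Linked _<_ (b ∷ J) → a < b → a ∉ b ∷ J
∉-below-head l a<b (here refl) = <-irrefl refl a<b
∉-below-head l a<b (there a∈J) = <-irrefl refl (<-trans a<b (All.lookup (head-bounds <-trans l) a∈J))

∉-cons-head : ∀ {a x K L} → Linked _<_ (a ∷ K) → x ∈ K → x ∉ L → x ∉ a ∷ L
∉-cons-head l x∈K x∉L (here refl) = <-irrefl refl (All.lookup (head-bounds <-trans l) x∈K)
∉-cons-head l x∈K x∉L (there x∈L) = x∉L x∈L

findDiff : ∀ {I J} → Linked _<_ I → Linked _<_ J → I ≢ J → Diff I J ⊎ Diff J I
findDiff {[]}    {[]}    _  _  I≢J = ⊥-elim (I≢J refl)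
findDiff {a ∷ I} {[]}    _  _  _   = inj₁ (a , here refl , λ ())
findDiff {[]}    {b ∷ J} _  _  _   = inj₂ (b , here refl , λ ())
findDiff {a ∷ I} {b ∷ J} lI lJ I≢J with <-cmp a b
... | tri< a<b _ _ = inj₁ (a , here refl , ∉-below-head lJ a<b)
... | tri> _ _ b<a = inj₂ (b , here refl , ∉-below-head lI b<a)
... | tri≈ _ refl _ with findDiff (Linked.tail lI) (Linked.tail lJ) (I≢J ∘ cong (a ∷_))
...   | inj₁ (x , x∈I , x∉J) = inj₁ (x , there x∈I , ∉-cons-head lI x∈I x∉J)
...   | inj₂ (x , x∈J , x∉I) = inj₂ (x , there x∈J , ∉-cons-head lJ x∈J x∉I)

remove-member : ∀ {x : ℕ} {X} → x ∈ X → ∃ λ is → is ++ [ x ] ↭ X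
remove-member {x} x∈X with ∈-∃++ x∈X
... | us , vs , refl =
  us ++ vs , ↭-trans (↭-reflexive (++-assoc us vs [ x ])) (++⁺ˡ us (↭-sym (∷↭∷ʳ x vs)))

HasRelation : ℕ → ℕ → ℕ → List ℕ → List ℕ → Set
HasRelation r s N X Y = Σ (PluckerTuple r s) λ P → ∃ λ rest →
  pluckerTerms (PluckerTuple.is P) (PluckerTuple.js P) ↭ (Sign.+ , X , Y) ∷ rest × All (Strict N) rest

relationFor : ∀ {r s N x X Y} → 1 ≤ r → x ∈ X → x ∉ Y →
  length X ≡ r → Linked _<_ X → All (_< r + s) X →
  length Y ≡ r → Linked _<_ Y → All (_< r + s) Y →
  sum X ≡ N → sum Y ≡ N → HasRelation r s N X Y
-- (Y is nonempty since r ≥ 1, which leaves room to place x after its head.)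
relationFor {Y = []} () _ _ _ _ _ refl _ _ _ _
relationFor {r} {s} {N} {x} {X} {y ∷ Y} _ x∈X x∉Y len-X X↗ X<r+s len-Y Y↗ Y<r+s sum-X sum-Y
  with remove-member x∈X
... | is , perm-X = P , exchangeRelation is perm-X X↗ Y↗ sum-X sum-Y pl
  where
  pl : Placement (sortSign (is ++ [ x ])) x (y ∷ Y)
  pl = place (sortSign (is ++ [ x ])) x y Y x∉Y
  open Placement pl using (js; perm)
  P : PluckerTuple r s
  P = record
    { is     = is
    ; js     = js
    ; is-len = trans (sym (length-++ is)) (trans (↭-length perm-X) len-X)
    ; js-len = trans (↭-length perm) (cong suc len-Y)
    ; is-bnd = ++⁻ˡ is (All-resp-↭ (↭-sym perm-X) X<r+s)
    ; js-bnd = All-resp-↭ (↭-sym perm) (All.lookup X<r+s x∈X ∷ Y<r+s)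
    }

mainTheorem11 : (r s N : ℕ) → 1 ≤ r → 1 ≤ s → 1 ≤ N → r ≤ N → N ≤ r * s →
    (I J : List ℕ) →
    length I ≡ r → Linked _<_ I → All (λ x → x < r + s) I →
    length J ≡ r → Linked _<_ J → All (λ x → x < r + s) J →
    sum I ≡ N → sum J ≡ N → I ≢ J →
    Σ (PluckerTuple r s) λ P → ∃ λ (rest : List Term) →
      ((pluckerTerms (PluckerTuple.is P) (PluckerTuple.js P) ↭ ((Sign.+ , I , J) ∷ rest))
        ⊎ (pluckerTerms (PluckerTuple.is P) (PluckerTuple.js P) ↭ ((Sign.+ , J , I) ∷ rest)))
      × All (λ { (ε , K , L) → (sum K < N × N < sum L) ⊎ (sum L < N × N < sum K) }) rest
mainTheorem11 r s N 1≤r _ _ _ _ I J len-I I↗ I<r+s len-J J↗ J<r+s sum-I sum-J I≢J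
  with findDiff I↗ J↗ I≢J
... | inj₁ (x , x∈I , x∉J)
  with relationFor 1≤r x∈I x∉J len-I I↗ I<r+s len-J J↗ J<r+s sum-I sum-J
...   | P , rest , p , strict = P , rest , inj₁ p , All.map (λ { {_ , _ , _} st → st }) strict
mainTheorem11 r s N 1≤r _ _ _ _ I J len-I I↗ I<r+s len-J J↗ J<r+s sum-I sum-J I≢J
  | inj₂ (x , x∈J , x∉I)
  with relationFor 1≤r x∈J x∉I len-J J↗ J<r+s len-I I↗ I<r+s sum-J sum-I
...   | P , rest , p , strict = P , rest , inj₂ p , All.map (λ { {_ , _ , _} st → st }) strict
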